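{- Let $w=w_1\cdots w_n$ be a word in $\{1,\dots,q\}$, let $s=\mathtt{LIS}(w)$, and let $P$ be the Hecke insertion tableau of $w$. Then the first row of $P$, read from left to right, is $w_{r(w,1)},w_{r(w,2)},\dots,w_{r(w,s)}$.
   Context: $\mathtt{LIS}(w)$ is the length of the longest strictly increasing subsequence of $w$. For $1\le t\le s$, $r(w,t)$ is the largest index $j$ such that the longest strictly increasing subsequence of $w$ ending at $w_j$ has length $t$. An increasing tableau is a filling of a Young diagram (English notation) strictly increasing along rows and columns. Hecke insertion of $x$ into an increasing tableau $T$: insert $x$ into the first row; inserting a value $x$ into a row $R$ (an empty row below the last row is allowed): if $x$ is $\ge$ every entry of $R$, append a box containing $x$ at the end of $R$ if this yields an increasing tableau, otherwise leave the tableau unchanged, and stop. Otherwise let $y$ be the smallest entry of $R$ strictly greater than $x$; replace $y$ by $x$ if this yields an increasing tableau; in either case insert $y$ into the next row. The Hecke insertion tableau of $w$ is $((\emptyset\leftarrow w_1)\leftarrow w_2)\cdots\leftarrow w_n$. -}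

module Defs where

open import Data.Nat using (ℕ; zero; suc; _<_; _≤_; _<ᵇ_; _≤ᵇ_)
open import Data.Bool using (Bool; true; false; _∧_; if_then_else_)
open import Data.List using (List; []; _∷_; _++_; [_]; length; reverse; foldl; lookup)
open import Data.Fin using (Fin; toℕ; fromℕ)
open import Data.Product using (Σ; _×_; proj₁)
open import Data.Empty using (⊥)
open import Relation.Binary.PropositionalEquality using (_≡_)

-- Tableaux: a tableau is a list of rows (English notation, top row first).

Tableau : Set
Tableau = List (List ℕ)

rowInc : List ℕ → Bool
rowInc []           = true
rowInc (x ∷ [])     = true
rowInc (x ∷ y ∷ xs) = (x <ᵇ y) ∧ rowInc (y ∷ xs)

colInc : List ℕ → List ℕ → Bool
colInc _        []       = true
colInc []       (_ ∷ _)  = false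
colInc (a ∷ as) (b ∷ bs) = (a <ᵇ b) ∧ colInc as bs

isIncTab : Tableau → Bool
isIncTab []             = true
isIncTab ([] ∷ _)       = false
isIncTab (R ∷ [])       = rowInc R
isIncTab (R ∷ S ∷ Rs)   = rowInc R ∧ colInc R S ∧ isIncTab (S ∷ Rs)

geAll : ℕ → List ℕ → Bool
geAll x []       = true
geAll x (y ∷ ys) = (y ≤ᵇ x) ∧ geAll x ys

-- smallest entry of R strictly greater than x (R increasing, so the first one);
-- only used when not (geAll x R)
firstGreater : ℕ → List ℕ → ℕ
firstGreater x []       = x
firstGreater x (y ∷ ys) = if x <ᵇ y then y else firstGreater x ys

replace : ℕ → ℕ → List ℕ → List ℕ
replace y x []       = []
replace y x (z ∷ zs) = if (z ≤ᵇ y) ∧ (y ≤ᵇ z) then x ∷ zs else z ∷ replace y x zs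

-- Hecke insertion.  'go x above rows' inserts x into the first row of 'rows';
-- 'above' holds the rows already processed (in reverse order), so that the
-- "if this yields an increasing tableau" test is made on the whole tableau.

heckeGo : ℕ → List (List ℕ) → Tableau → Tableau
heckeGo x above [] =
  let cand = reverse above ++ [ [ x ] ] in
  if isIncTab cand then cand else reverse above
heckeGo x above (R ∷ Rs) =
  if geAll x R
  then (let cand = reverse above ++ ((R ++ [ x ]) ∷ Rs) in
        if isIncTab cand then cand else reverse above ++ (R ∷ Rs))
  else (let y  = firstGreater x R
            R' = replace y x R in
        if isIncTab (reverse above ++ (R' ∷ Rs))
        then heckeGo y (R' ∷ above) Rs
        else heckeGo y (R ∷ above) Rs)

heckeInsert : Tableau → ℕ → Tableau
heckeInsert T x = heckeGo x [] T

heckeTableau : List ℕ → Tableau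
heckeTableau w = foldl heckeInsert [] w

firstRow : Tableau → List ℕ
firstRow []      = []
firstRow (R ∷ _) = R

-- Increasing subsequences (positions are Fin (length w), 0-based)

IncSubseq : List ℕ → ℕ → Set
IncSubseq w t =
  Σ (Fin t → Fin (length w)) λ f →
    (∀ a b → toℕ a < toℕ b → toℕ (f a) < toℕ (f b)) ×
    (∀ a b → toℕ a < toℕ b → lookup w (f a) < lookup w (f b))

IncSubseqEndingAt : (w : List ℕ) → Fin (length w) → ℕ → Set
IncSubseqEndingAt w j zero    = ⊥
IncSubseqEndingAt w j (suc t) =
  Σ (IncSubseq w (suc t)) λ p → proj₁ p (fromℕ t) ≡ j

IsLIS : List ℕ → ℕ → Set
IsLIS w s = IncSubseq w s × (∀ t → IncSubseq w t → t ≤ s)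

LongestEndingAt : (w : List ℕ) → Fin (length w) → ℕ → Set
LongestEndingAt w j t =
  IncSubseqEndingAt w j t × (∀ t' → IncSubseqEndingAt w j t' → t' ≤ t)

IsR : (w : List ℕ) → ℕ → Fin (length w) → Set
IsR w t j =
  LongestEndingAt w j t × (∀ j' → LongestEndingAt w j' t → toℕ j' ≤ toℕ j)

module Submission where

-- On the first row, Hecke insertion of x acts as patience sorting:
-- x replaces the smallest entry > x, is appended if it exceeds every entry,
-- and leaves the row unchanged if x already occurs in it (the other choices
-- would break strict increase of the row; the lower rows never obstruct).
-- Patience sorting maintains the classical invariant that the t-th entry of
-- the row is the least value ending an increasing subsequence of length t+1
-- and that the row is as long as the longest increasing subsequence.  From
-- that invariant alone one reads off both LIS(w) = length of the row and,
-- comparing with the last position r(w,t+1), that the t-th entry is w_{r(w,t+1)}.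

open import Defs
open import Data.Nat using (ℕ; zero; suc; _≤_; _<_; _<ᵇ_; _≤ᵇ_; z≤n; s≤s; z<s; s<s; s<s⁻¹; s≤s⁻¹)
open import Data.Nat.Properties
open import Data.Bool using (true; false; _∧_; if_then_else_; T)
open import Data.Bool.Properties using (∧-identityʳ; ∧-zeroʳ)
open import Data.List using (List; []; _∷_; _++_; [_]; _∷ʳ_; length; reverse; lookup; tabulate)
open import Data.List.Properties using (foldl-∷ʳ; unfold-reverse; ++-assoc; ++-identityʳ)
open import Data.List.Reverse using (Reverse; reverseView; []; _∶_∶ʳ_)
open import Data.List.Relation.Unary.All using (All)
open import Data.Fin using (Fin; toℕ; fromℕ; fromℕ<; inject₁) renaming (zero to fzero; suc to fsuc)
open import Data.Fin.Properties using (toℕ-fromℕ; toℕ-injective; toℕ<n; toℕ-inject₁; toℕ-fromℕ<)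
open import Data.Unit using (⊤; tt)
open import Data.Empty using (⊥; ⊥-elim)
open import Data.Product using (Σ; _×_; _,_; proj₁; proj₂)
open import Data.Sum using (_⊎_; inj₁; inj₂)
open import Relation.Binary.PropositionalEquality using (_≡_; refl; sym; trans; cong; cong₂; subst; subst₂)
open import Relation.Binary.Definitions using (tri<; tri≈; tri>)

T⇒≡ : ∀ {b} → T b → b ≡ true
T⇒≡ {true} _ = refl

≡⇒T : ∀ {b} → b ≡ true → T b
≡⇒T refl = tt

∧-true : ∀ a b → a ∧ b ≡ true → a ≡ true × b ≡ true
∧-true true  true  _ = refl , refl
∧-true true  false ()
∧-true false _     ()

<ᵇ-true : ∀ {m n} → m < n → (m <ᵇ n) ≡ true
<ᵇ-true p = T⇒≡ (<⇒<ᵇ p)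

<ᵇ-sound : ∀ {m n} → (m <ᵇ n) ≡ true → m < n
<ᵇ-sound {m} {n} e = <ᵇ⇒< m n (≡⇒T e)

<ᵇ-false : ∀ {m n} → n ≤ m → (m <ᵇ n) ≡ false
<ᵇ-false {m} {n} p with m <ᵇ n in e
... | false = refl
... | true  = ⊥-elim (≤⇒≯ p (<ᵇ-sound e))

<ᵇ-false-sound : ∀ {m n} → (m <ᵇ n) ≡ false → n ≤ m
<ᵇ-false-sound e = ≮⇒≥ λ p → subst T e (<⇒<ᵇ p)

≤ᵇ-true : ∀ {m n} → m ≤ n → (m ≤ᵇ n) ≡ true
≤ᵇ-true p = T⇒≡ (≤⇒≤ᵇ p)

≤ᵇ-sound : ∀ {m n} → (m ≤ᵇ n) ≡ true → m ≤ n
≤ᵇ-sound {m} {n} e = ≤ᵇ⇒≤ m n (≡⇒T e)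

≤ᵇ-false : ∀ {m n} → n < m → (m ≤ᵇ n) ≡ false
≤ᵇ-false {m} {n} p with m ≤ᵇ n in e
... | false = refl
... | true  = ⊥-elim (<⇒≱ p (≤ᵇ-sound e))

rowInsert : ℕ → List ℕ → List ℕ
rowInsert x [] = [ x ]
rowInsert x (y ∷ ys) with <-cmp x y
... | tri< _ _ _ = x ∷ ys
... | tri≈ _ _ _ = y ∷ ys
... | tri> _ _ _ = y ∷ rowInsert x ys

-- Entry i of a list (0-based), 0 past the end.
infixl 9 _!_
_!_ : List ℕ → ℕ → ℕ
[]       ! _     = 0
(x ∷ xs) ! zero  = x
(x ∷ xs) ! suc i = xs ! i

rowInc-tail : ∀ y ys → rowInc (y ∷ ys) ≡ true → rowInc ys ≡ true
rowInc-tail y []       h = refl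
rowInc-tail y (z ∷ zs) h = proj₂ (∧-true (y <ᵇ z) _ h)

rowInc-head : ∀ y z zs → rowInc (y ∷ z ∷ zs) ≡ true → y < z
rowInc-head y z zs h = <ᵇ-sound (proj₁ (∧-true (y <ᵇ z) _ h))

BelowHead : ℕ → List ℕ → Set
BelowHead y []      = ⊤
BelowHead y (z ∷ _) = y < z

rowInc-cons : ∀ y L → BelowHead y L → rowInc (y ∷ L) ≡ rowInc L
rowInc-cons y []       p = refl
rowInc-cons y (z ∷ zs) p rewrite <ᵇ-true p = refl

belowHead-of : ∀ y ys → rowInc (y ∷ ys) ≡ true → BelowHead y ys
belowHead-of y []       h = tt
belowHead-of y (z ∷ zs) h = rowInc-head y z zs h

rowInc-lower : ∀ x y ys → x < y → rowInc (y ∷ ys) ≡ true → rowInc (x ∷ ys) ≡ true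
rowInc-lower x y ys p h = trans (rowInc-cons x ys (lower ys (belowHead-of y ys h))) (rowInc-tail y ys h)
  where lower : ∀ ys → BelowHead y ys → BelowHead x ys
        lower []       _   = tt
        lower (z ∷ zs) y<z = <-trans p y<z

rowInc-< : ∀ R i j → rowInc R ≡ true → i < j → j < length R → R ! i < R ! j
rowInc-< (y ∷ z ∷ zs) zero    (suc zero)    h p q = rowInc-head y z zs h
rowInc-< (y ∷ z ∷ zs) zero    (suc (suc j)) h p (s<s q) =
  <-trans (rowInc-head y z zs h) (rowInc-< (z ∷ zs) zero (suc j) (rowInc-tail y (z ∷ zs) h) z<s q)
rowInc-< (y ∷ ys)     (suc i) (suc j)       h (s<s p) (s<s q) = rowInc-< ys i j (rowInc-tail y ys h) p q

rowInc-≤ : ∀ R i j → rowInc R ≡ true → i ≤ j → j < length R → R ! i ≤ R ! j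
rowInc-≤ R i j h p q with m≤n⇒m<n∨m≡n p
... | inj₁ i<j  = <⇒≤ (rowInc-< R i j h i<j q)
... | inj₂ refl = ≤-refl

rowInc-reflect : ∀ R k t → rowInc R ≡ true → R ! k ≤ R ! t → k < length R → k ≤ t
rowInc-reflect R k t h le q = ≮⇒≥ λ t<k → <⇒≱ (rowInc-< R t k h t<k q) le

rowInsert-increasing : ∀ x R → rowInc R ≡ true → rowInc (rowInsert x R) ≡ true
rowInsert-increasing x []       h = refl
rowInsert-increasing x (y ∷ ys) h with <-cmp x y
... | tri< p _ _ = rowInc-lower x y ys p h
... | tri≈ _ _ _ = h
... | tri> _ _ p = trans (rowInc-cons y (rowInsert x ys) (stays ys (belowHead-of y ys h)))
                         (rowInsert-increasing x ys (rowInc-tail y ys h))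
  where stays : ∀ ys → BelowHead y ys → BelowHead y (rowInsert x ys)
        stays []       _ = p
        stays (z ∷ zs) l with <-cmp x z
        ... | tri< _ _ _ = p
        ... | tri≈ _ _ _ = l
        ... | tri> _ _ _ = l

rowInsert-length : ∀ x R → length R ≤ length (rowInsert x R)
rowInsert-length x []       = z≤n
rowInsert-length x (y ∷ ys) with <-cmp x y
... | tri< _ _ _ = ≤-refl
... | tri≈ _ _ _ = ≤-refl
... | tri> _ _ _ = s≤s (rowInsert-length x ys)

rowInsert-≤ : ∀ x R t → t < length R → rowInsert x R ! t ≤ R ! t
rowInsert-≤ x (y ∷ ys) t q with <-cmp x y
rowInsert-≤ x (y ∷ ys) zero    q       | tri< p _ _ = <⇒≤ p
rowInsert-≤ x (y ∷ ys) (suc t) q       | tri< _ _ _ = ≤-refl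
rowInsert-≤ x (y ∷ ys) t       q       | tri≈ _ _ _ = ≤-refl
rowInsert-≤ x (y ∷ ys) zero    q       | tri> _ _ _ = ≤-refl
rowInsert-≤ x (y ∷ ys) (suc t) (s<s q) | tri> _ _ _ = rowInsert-≤ x ys t q

AllBelow : ℕ → List ℕ → ℕ → Set
AllBelow x R t = ∀ t′ → t′ < t → t′ < length R × R ! t′ < x

rowInsert-entry : ∀ x R t → t < length (rowInsert x R) →
  (t < length R × rowInsert x R ! t ≡ R ! t) ⊎ (rowInsert x R ! t ≡ x × AllBelow x R t)
rowInsert-entry x []       zero    q       = inj₂ (refl , λ _ ())
rowInsert-entry x []       (suc t) (s<s ())
rowInsert-entry x (y ∷ ys) t       q with <-cmp x y
rowInsert-entry x (y ∷ ys) zero    q       | tri< _ _ _ = inj₂ (refl , λ _ ())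
rowInsert-entry x (y ∷ ys) (suc t) q       | tri< _ _ _ = inj₁ (q , refl)
rowInsert-entry x (y ∷ ys) t       q       | tri≈ _ _ _ = inj₁ (q , refl)
rowInsert-entry x (y ∷ ys) zero    q       | tri> _ _ _ = inj₁ (z<s , refl)
rowInsert-entry x (y ∷ ys) (suc t) (s<s q) | tri> _ _ y<x with rowInsert-entry x ys t q
... | inj₁ (t<len , same) = inj₁ (s<s t<len , same)
... | inj₂ (isX , below)  = inj₂ (isX , below′)
  where below′ : AllBelow x (y ∷ ys) (suc t)
        below′ zero     _       = z<s , y<x
        below′ (suc t′) (s<s r) = s<s (proj₁ (below t′ r)) , proj₂ (below t′ r)

rowInsert-bound : ∀ x R j → AllBelow x R j → j < length (rowInsert x R) × rowInsert x R ! j ≤ x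
rowInsert-bound x []       zero    _ = z<s , ≤-refl
rowInsert-bound x []       (suc j) below with proj₁ (below zero z<s)
... | ()
rowInsert-bound x (y ∷ ys) j       below with <-cmp x y
rowInsert-bound x (y ∷ ys) zero    below | tri< _ _ _   = z<s , ≤-refl
rowInsert-bound x (y ∷ ys) (suc j) below | tri< x<y _ _ = ⊥-elim (<-asym x<y (proj₂ (below zero z<s)))
rowInsert-bound x (y ∷ ys) zero    below | tri≈ _ x≡y _ = z<s , ≤-reflexive (sym x≡y)
rowInsert-bound x (y ∷ ys) (suc j) below | tri≈ _ x≡y _ = ⊥-elim (<-irrefl (sym x≡y) (proj₂ (below zero z<s)))
rowInsert-bound x (y ∷ ys) zero    below | tri> _ _ y<x = z<s , <⇒≤ y<x
rowInsert-bound x (y ∷ ys) (suc j) below | tri> _ _ _ =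
  let (j<len , bound) = rowInsert-bound x ys j (λ t′ q → let (a , b) = below (suc t′) (s<s q) in s<s⁻¹ a , b)
  in s<s j<len , bound

rev-cons : ∀ (R : List ℕ) above rest → reverse (R ∷ above) ++ rest ≡ reverse above ++ (R ∷ rest)
rev-cons R above rest = trans (cong (_++ rest) (unfold-reverse R above)) (++-assoc (reverse above) [ R ] rest)

heckeGo-prefix : ∀ x above rows → Σ Tableau λ Y → heckeGo x above rows ≡ reverse above ++ Y
heckeGo-prefix x above [] with isIncTab (reverse above ++ [ [ x ] ])
... | true  = [ [ x ] ] , refl
... | false = [] , sym (++-identityʳ _)
heckeGo-prefix x above (R ∷ Rs) with geAll x R
... | true with isIncTab (reverse above ++ ((R ++ [ x ]) ∷ Rs))
...   | true  = _ , refl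
...   | false = _ , refl
heckeGo-prefix x above (R ∷ Rs) | false with isIncTab (reverse above ++ (replace (firstGreater x R) x R ∷ Rs))
... | true  = let (Y , e) = heckeGo-prefix _ _ Rs in _ , trans e (rev-cons _ above Y)
... | false = let (Y , e) = heckeGo-prefix _ _ Rs in _ , trans e (rev-cons _ above Y)

-- Every change heckeGo makes is guarded by an isIncTab test.
heckeGo-increasing : ∀ x above rows → isIncTab (reverse above ++ rows) ≡ true →
  isIncTab (heckeGo x above rows) ≡ true
heckeGo-increasing x above [] h with isIncTab (reverse above ++ [ [ x ] ]) in e
... | true  = e
... | false = trans (cong isIncTab (sym (++-identityʳ (reverse above)))) h
heckeGo-increasing x above (R ∷ Rs) h with geAll x R
... | true with isIncTab (reverse above ++ ((R ++ [ x ]) ∷ Rs)) in e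
...   | true  = e
...   | false = h
heckeGo-increasing x above (R ∷ Rs) h | false with isIncTab (reverse above ++ (replace (firstGreater x R) x R ∷ Rs)) in e
... | true  = heckeGo-increasing _ _ Rs (trans (cong isIncTab (rev-cons _ above Rs)) e)
... | false = heckeGo-increasing _ _ Rs (trans (cong isIncTab (rev-cons R above Rs)) h)

heckeInsert-increasing : ∀ T x → isIncTab T ≡ true → isIncTab (heckeInsert T x) ≡ true
heckeInsert-increasing T x = heckeGo-increasing x [] T

NonEmpty : List ℕ → Set
NonEmpty []      = ⊥
NonEmpty (_ ∷ _) = ⊤

isIncTab-newTop : ∀ R R₁ Rs → isIncTab (R ∷ Rs) ≡ true → NonEmpty R₁ →
  (∀ S → colInc R S ≡ true → colInc R₁ S ≡ true) → isIncTab (R₁ ∷ Rs) ≡ rowInc R₁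
isIncTab-newTop []       R₁       Rs       () _ _
isIncTab-newTop (a ∷ as) (b ∷ bs) []       h _ _ = refl
isIncTab-newTop (a ∷ as) (b ∷ bs) (S ∷ Rs) h _ fits =
  let (_ , rest) = ∧-true (rowInc (a ∷ as)) _ h
      (col , lower) = ∧-true (colInc (a ∷ as) S) _ rest
  in trans (cong₂ (λ c d → rowInc (b ∷ bs) ∧ c ∧ d) (fits S col) lower) (∧-identityʳ _)

nonEmpty-top : ∀ R Rs → isIncTab (R ∷ Rs) ≡ true → NonEmpty R
nonEmpty-top []      Rs ()
nonEmpty-top (_ ∷ _) Rs _ = tt

rowInc-top : ∀ R Rs → isIncTab (R ∷ Rs) ≡ true → rowInc R ≡ true
rowInc-top []       Rs       ()
rowInc-top (a ∷ as) []       h = h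
rowInc-top (a ∷ as) (S ∷ Rs) h = proj₁ (∧-true _ _ h)

colInc-append : ∀ R X S → colInc R S ≡ true → colInc (R ++ X) S ≡ true
colInc-append R        X []       h = refl
colInc-append []       X (b ∷ bs) ()
colInc-append (a ∷ as) X (b ∷ bs) h =
  let (a<b , rest) = ∧-true (a <ᵇ b) _ h in cong₂ _∧_ a<b (colInc-append as X bs rest)

colInc-replace : ∀ y x R S → x ≤ y → colInc R S ≡ true → colInc (replace y x R) S ≡ true
colInc-replace y x R        []       x≤y h = refl
colInc-replace y x []       (b ∷ bs) x≤y h = h
colInc-replace y x (z ∷ zs) (b ∷ bs) x≤y h with ∧-true (z <ᵇ b) _ h | (z ≤ᵇ y) ∧ (y ≤ᵇ z) in hit
... | z<b , rest | true  =
  let x≤z = ≤-trans x≤y (≤ᵇ-sound {y} {z} (proj₂ (∧-true (z ≤ᵇ y) _ hit)))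
  in cong₂ _∧_ (<ᵇ-true {x} {b} (≤-<-trans x≤z (<ᵇ-sound {z} z<b))) rest
... | z<b , rest | false = cong₂ _∧_ z<b (colInc-replace y x zs bs x≤y rest)

nonEmpty-append : ∀ R x → NonEmpty (R ++ [ x ])
nonEmpty-append []      x = tt
nonEmpty-append (_ ∷ _) x = tt

nonEmpty-replace : ∀ y x R → NonEmpty R → NonEmpty (replace y x R)
nonEmpty-replace y x (z ∷ zs) _ with (z ≤ᵇ y) ∧ (y ≤ᵇ z)
... | true  = tt
... | false = tt

firstGreater-> : ∀ x R → geAll x R ≡ false → x < firstGreater x R
firstGreater-> x []       ()
firstGreater-> x (z ∷ zs) h with x <ᵇ z in x<z
... | true  = <ᵇ-sound x<z
... | false = firstGreater-> x zs (trans (sym (cong (_∧ geAll x zs) (≤ᵇ-true {z} {x} (<ᵇ-false-sound x<z)))) h)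

-- The top row after Hecke insertion, as read off from heckeGo: the candidate row
-- is accepted exactly when it is itself increasing.
topRowRule : ℕ → List ℕ → List ℕ
topRowRule x R =
  if geAll x R
  then (if rowInc (R ++ [ x ]) then R ++ [ x ] else R)
  else (let R′ = replace (firstGreater x R) x R in if rowInc R′ then R′ else R)

firstRow-heckeInsert-rule : ∀ x R Rs → isIncTab (R ∷ Rs) ≡ true →
  firstRow (heckeInsert (R ∷ Rs) x) ≡ topRowRule x R
firstRow-heckeInsert-rule x R Rs h with geAll x R in ge
... | true rewrite isIncTab-newTop R (R ++ [ x ]) Rs h (nonEmpty-append R x) (λ S → colInc-append R [ x ] S)
  with rowInc (R ++ [ x ])
...   | true  = refl
...   | false = refl
firstRow-heckeInsert-rule x R Rs h | false
  rewrite isIncTab-newTop R (replace (firstGreater x R) x R) Rs h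
            (nonEmpty-replace _ x R (nonEmpty-top R Rs h))
            (λ S → colInc-replace _ x R S (<⇒≤ (firstGreater-> x R ge)))
  with rowInc (replace (firstGreater x R) x R)
... | true  = cong firstRow (proj₂ (heckeGo-prefix _ (_ ∷ []) Rs))
... | false = cong firstRow (proj₂ (heckeGo-prefix _ (_ ∷ []) Rs))

-- For an increasing row the rule above is rowInsert.  Entries below x are skipped
-- by both; if x occurs, both candidate rows would repeat x and are rejected.

replace-skip : ∀ f x y ys → y < f → replace f x (y ∷ ys) ≡ y ∷ replace f x ys
replace-skip f x y ys y<f rewrite ≤ᵇ-false {f} {y} y<f | ∧-zeroʳ (y ≤ᵇ f) = refl

belowHead-replace : ∀ f x y z zs → y < x → y < z → BelowHead y (replace f x (z ∷ zs))
belowHead-replace f x y z zs y<x y<z with (z ≤ᵇ f) ∧ (f ≤ᵇ z)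
... | true  = y<x
... | false = y<z

topRowRule-skip : ∀ x y ys → y < x → rowInc (y ∷ ys) ≡ true →
  topRowRule x (y ∷ ys) ≡ y ∷ topRowRule x ys
topRowRule-skip x y []       y<x h rewrite ≤ᵇ-true (<⇒≤ y<x) | <ᵇ-true y<x = refl
topRowRule-skip x y (z ∷ zs) y<x h rewrite ≤ᵇ-true (<⇒≤ y<x) | <ᵇ-true (rowInc-head y z zs h)
  with geAll x (z ∷ zs) in ge
... | true with rowInc ((z ∷ zs) ++ [ x ])
...   | true  = refl
...   | false = refl
topRowRule-skip x y (z ∷ zs) y<x h | false
  rewrite <ᵇ-false {x} {y} (<⇒≤ y<x)
        | replace-skip (firstGreater x (z ∷ zs)) x y (z ∷ zs) (<-trans y<x (firstGreater-> x (z ∷ zs) ge))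
        | rowInc-cons y _ (belowHead-replace (firstGreater x (z ∷ zs)) x y z zs y<x (rowInc-head y z zs h))
  with rowInc (replace (firstGreater x (z ∷ zs)) x (z ∷ zs))
... | true  = refl
... | false = refl

topRowRule-present : ∀ x ys → rowInc (x ∷ ys) ≡ true → topRowRule x (x ∷ ys) ≡ x ∷ ys
topRowRule-present x []       h rewrite ≤ᵇ-true (≤-refl {x}) | <ᵇ-false (≤-refl {x}) = refl
topRowRule-present x (z ∷ zs) h with rowInc-head x z zs h
... | x<z rewrite ≤ᵇ-true (≤-refl {x}) | ≤ᵇ-false {z} {x} x<z | <ᵇ-false (≤-refl {x}) | <ᵇ-true x<z
                | ≤ᵇ-true (<⇒≤ x<z) | ≤ᵇ-true (≤-refl {z}) | ≤ᵇ-false {z} {x} x<z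
                | <ᵇ-false (≤-refl {x}) = refl

topRowRule-rowInsert : ∀ x R → rowInc R ≡ true → topRowRule x R ≡ rowInsert x R
topRowRule-rowInsert x []       h = refl
topRowRule-rowInsert x (y ∷ ys) h with <-cmp x y
... | tri< x<y _ _
  rewrite ≤ᵇ-false {y} {x} x<y | <ᵇ-true x<y | ≤ᵇ-true (≤-refl {y}) | rowInc-lower x y ys x<y h = refl
... | tri≈ _ refl _ = topRowRule-present x ys h
... | tri> _ _ y<x =
  trans (topRowRule-skip x y ys y<x h) (cong (y ∷_) (topRowRule-rowInsert x ys (rowInc-tail y ys h)))

firstRow-heckeInsert : ∀ T x → isIncTab T ≡ true → firstRow (heckeInsert T x) ≡ rowInsert x (firstRow T)
firstRow-heckeInsert []       x h = refl
firstRow-heckeInsert (R ∷ Rs) x h =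
  trans (firstRow-heckeInsert-rule x R Rs h) (topRowRule-rowInsert x R (rowInc-top R Rs h))

-- (3) Chains: increasing subsequences of w of length k+1, given by their positions in ℕ.

Increasing : ∀ {n} → (Fin n → ℕ) → Set
Increasing h = ∀ a b → toℕ a < toℕ b → h a < h b

increasing-cong : ∀ {n} {h h′ : Fin n → ℕ} → (∀ a → h a ≡ h′ a) → Increasing h → Increasing h′
increasing-cong e inc a b p = subst₂ _<_ (e a) (e b) (inc a b p)

increasing-≤-last : ∀ {n} (h : Fin (suc n) → ℕ) → Increasing h → ∀ a → h a ≤ h (fromℕ n)
increasing-≤-last {n} h inc a with m≤n⇒m<n∨m≡n (s≤s⁻¹ (toℕ<n a))
... | inj₁ a<n = <⇒≤ (inc a (fromℕ n) (subst (toℕ a <_) (sym (toℕ-fromℕ n)) a<n))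
... | inj₂ a≡n = ≤-reflexive (cong h (toℕ-injective (trans a≡n (sym (toℕ-fromℕ n)))))

snoc : ∀ {n} → (Fin n → ℕ) → ℕ → Fin (suc n) → ℕ
snoc {zero}  f c fzero    = c
snoc {suc n} f c fzero    = f fzero
snoc {suc n} f c (fsuc i) = snoc (λ j → f (fsuc j)) c i

snoc-last : ∀ {n} (f : Fin n → ℕ) c → snoc f c (fromℕ n) ≡ c
snoc-last {zero}  f c = refl
snoc-last {suc n} f c = snoc-last (λ j → f (fsuc j)) c

snoc-all : ∀ {n} (f : Fin n → ℕ) c (Q : ℕ → Set) → Q c → (∀ j → Q (f j)) → ∀ a → Q (snoc f c a)
snoc-all {zero}  f c Q qc qf fzero    = qc
snoc-all {suc n} f c Q qc qf fzero    = qf fzero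
snoc-all {suc n} f c Q qc qf (fsuc i) = snoc-all (λ j → f (fsuc j)) c Q qc (λ j → qf (fsuc j)) i

snoc-map : ∀ {n} (F : ℕ → ℕ) (f : Fin n → ℕ) c a → F (snoc f c a) ≡ snoc (λ j → F (f j)) (F c) a
snoc-map {zero}  F f c fzero    = refl
snoc-map {suc n} F f c fzero    = refl
snoc-map {suc n} F f c (fsuc i) = snoc-map F (λ j → f (fsuc j)) c i

snoc-increasing : ∀ {n} (f : Fin n → ℕ) c → Increasing f → (∀ a → f a < c) → Increasing (snoc f c)
snoc-increasing {zero}  f c inc lt fzero    fzero    ()
snoc-increasing {suc n} f c inc lt fzero    fzero    ()
snoc-increasing {suc n} f c inc lt fzero    (fsuc j) p =
  snoc-all (λ j → f (fsuc j)) c (f fzero <_) (lt fzero) (λ j → inc fzero (fsuc j) z<s) j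
snoc-increasing {suc n} f c inc lt (fsuc i) fzero    ()
snoc-increasing {suc n} f c inc lt (fsuc i) (fsuc j) (s<s p) =
  snoc-increasing (λ j → f (fsuc j)) c (λ a b q → inc (fsuc a) (fsuc b) (s<s q)) (λ a → lt (fsuc a)) i j p

record Chain (w : List ℕ) (k : ℕ) : Set where
  field
    pos       : Fin (suc k) → ℕ
    pos-inc   : Increasing pos
    pos-range : ∀ a → pos a < length w
    val-inc   : Increasing (λ a → w ! pos a)

  end : ℕ
  end = pos (fromℕ k)

  endValue : ℕ
  endValue = w ! end

open Chain

single : ∀ {w} P → P < length w → Chain w 0
single P P<len = record { pos = λ _ → P ; pos-inc = λ { fzero fzero () } ; pos-range = λ _ → P<len
                        ; val-inc = λ { fzero fzero () } }

extend : ∀ {w k} (c : Chain w k) P → P < length w → end c < P → endValue c < w ! P → Chain w (suc k)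
extend {w} c P P<len end<P val<P = record
  { pos       = snoc (pos c) P
  ; pos-inc   = snoc-increasing (pos c) P (pos-inc c) (λ a → ≤-<-trans (increasing-≤-last _ (pos-inc c) a) end<P)
  ; pos-range = snoc-all (pos c) P (_< length w) P<len (pos-range c)
  ; val-inc   = increasing-cong (λ a → sym (snoc-map (w !_) (pos c) P a))
                  (snoc-increasing _ (w ! P) (val-inc c) (λ a → ≤-<-trans (increasing-≤-last _ (val-inc c) a) val<P))
  }

extend-end : ∀ {w k} (c : Chain w k) P P<len end<P val<P → end (extend c P P<len end<P val<P) ≡ P
extend-end c P _ _ _ = snoc-last (pos c) P

dropLast : ∀ {w k} → Chain w (suc k) → Chain w k
dropLast c = record
  { pos       = λ a → pos c (inject₁ a)
  ; pos-inc   = λ a b p → pos-inc c _ _ (subst₂ _<_ (sym (toℕ-inject₁ a)) (sym (toℕ-inject₁ b)) p)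
  ; pos-range = λ a → pos-range c (inject₁ a)
  ; val-inc   = λ a b p → val-inc c _ _ (subst₂ _<_ (sym (toℕ-inject₁ a)) (sym (toℕ-inject₁ b)) p)
  }

dropLast-below : ∀ {w k} (c : Chain w (suc k)) → end (dropLast c) < end c × endValue (dropLast c) < endValue c
dropLast-below {k = k} c = pos-inc c _ _ before , val-inc c _ _ before
  where before : toℕ (inject₁ (fromℕ k)) < toℕ (fromℕ (suc k))
        before rewrite toℕ-inject₁ (fromℕ k) | toℕ-fromℕ k = ≤-refl

length-∷ʳ : ∀ (w : List ℕ) x → length (w ∷ʳ x) ≡ suc (length w)
length-∷ʳ []      x = refl
length-∷ʳ (_ ∷ w) x = cong suc (length-∷ʳ w x)

!-∷ʳ-old : ∀ w x i → i < length w → (w ∷ʳ x) ! i ≡ w ! i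
!-∷ʳ-old (y ∷ w) x zero    _       = refl
!-∷ʳ-old (y ∷ w) x (suc i) (s<s p) = !-∷ʳ-old w x i p

!-∷ʳ-new : ∀ w x → (w ∷ʳ x) ! length w ≡ x
!-∷ʳ-new []      x = refl
!-∷ʳ-new (y ∷ w) x = !-∷ʳ-new w x

lift : ∀ {w k} x → Chain w k → Chain (w ∷ʳ x) k
lift {w} x c = record
  { pos       = pos c
  ; pos-inc   = pos-inc c
  ; pos-range = λ a → subst (pos c a <_) (sym (length-∷ʳ w x)) (m≤n⇒m≤1+n (pos-range c a))
  ; val-inc   = increasing-cong (λ a → sym (!-∷ʳ-old w x (pos c a) (pos-range c a))) (val-inc c)
  }

lift-endValue : ∀ {w k} x (c : Chain w k) → endValue (lift x c) ≡ endValue c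
lift-endValue {w} {k} x c = !-∷ʳ-old w x _ (pos-range c (fromℕ k))

restrict : ∀ {w k x} (c : Chain (w ∷ʳ x) k) → end c < length w → Chain w k
restrict {w} {k} {x} c end<len = record
  { pos       = pos c
  ; pos-inc   = pos-inc c
  ; pos-range = inRange
  ; val-inc   = increasing-cong (λ a → !-∷ʳ-old w x (pos c a) (inRange a)) (val-inc c)
  }
  where inRange : ∀ a → pos c a < length w
        inRange a = ≤-<-trans (increasing-≤-last _ (pos-inc c) a) end<len

restrict-endValue : ∀ {w k x} (c : Chain (w ∷ʳ x) k) end<len → endValue (restrict c end<len) ≡ endValue c
restrict-endValue {w} {x = x} c end<len = sym (!-∷ʳ-old w x (end c) end<len)

-- (4) The patience invariant: R lists, for each length t+1, the least value ending an
-- increasing subsequence of w of that length, and no increasing subsequence is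
-- longer than R.

record PatienceRow (w : List ℕ) (R : List ℕ) : Set where
  field
    increasing : rowInc R ≡ true
    attained   : ∀ t → t < length R → Σ (Chain w t) λ c → endValue c ≡ R ! t
    least      : ∀ {k} (c : Chain w k) → k < length R × R ! k ≤ endValue c

open PatienceRow

patience-[] : PatienceRow [] []
patience-[] = record { increasing = refl ; attained = λ _ () ; least = λ {k} c → noChain (pos-range c (fromℕ k)) }
  where noChain : ∀ {A : Set} {i} → i < 0 → A
        noChain ()

patience-∷ʳ : ∀ {w R} x → PatienceRow w R → PatienceRow (w ∷ʳ x) (rowInsert x R)
patience-∷ʳ {w} {R} x inv = record
  { increasing = rowInsert-increasing x R (increasing inv)
  ; attained   = attained′
  ; least      = least′
  }
  where
  newPos : length w < length (w ∷ʳ x)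
  newPos = subst (length w <_) (sym (length-∷ʳ w x)) ≤-refl

  endingInX : ∀ t → AllBelow x R t → Σ (Chain (w ∷ʳ x) t) λ c → endValue c ≡ x
  endingInX zero    _     = single (length w) newPos , !-∷ʳ-new w x
  endingInX (suc t) below =
    let (t<len , Rt<x) = below t ≤-refl
        (c , c-ends-Rt) = attained inv t t<len
        smaller : endValue (lift x c) < (w ∷ʳ x) ! length w
        smaller = subst₂ _<_ (sym (trans (lift-endValue x c) c-ends-Rt)) (sym (!-∷ʳ-new w x)) Rt<x
        earlier = pos-range c (fromℕ t)
    in extend (lift x c) (length w) newPos earlier smaller
     , trans (cong ((w ∷ʳ x) !_) (extend-end (lift x c) (length w) newPos earlier smaller)) (!-∷ʳ-new w x)

  attained′ : ∀ t → t < length (rowInsert x R) → Σ (Chain (w ∷ʳ x) t) λ c → endValue c ≡ rowInsert x R ! t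
  attained′ t q with rowInsert-entry x R t q
  ... | inj₁ (t<len , same) =
    let (c , c-ends-Rt) = attained inv t t<len in lift x c , trans (lift-endValue x c) (trans c-ends-Rt (sym same))
  ... | inj₂ (isX , below) = let (c , c-ends-x) = endingInX t below in c , trans c-ends-x (sym isX)

  belowX : ∀ {k} (c : Chain (w ∷ʳ x) k) → end c ≡ length w → AllBelow x R k
  belowX {zero}   c _      _  ()
  belowX {suc k′} c endNew t′ (s≤s t′≤k′) =
    let (end< , value<) = dropLast-below c
        dropped<len = subst (end (dropLast c) <_) endNew end<
        c′ = restrict (dropLast c) dropped<len
        (k′<len , Rk′≤) = least inv c′
        Rk′<x : R ! k′ < x
        Rk′<x = ≤-<-trans (≤-trans Rk′≤ (≤-reflexive (restrict-endValue (dropLast c) dropped<len)))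
                  (subst (endValue (dropLast c) <_) (trans (cong ((w ∷ʳ x) !_) endNew) (!-∷ʳ-new w x)) value<)
    in ≤-<-trans t′≤k′ k′<len , ≤-<-trans (rowInc-≤ R t′ k′ (increasing inv) t′≤k′ k′<len) Rk′<x

  least′ : ∀ {k} (c : Chain (w ∷ʳ x) k) → k < length (rowInsert x R) × rowInsert x R ! k ≤ endValue c
  least′ {k} c with m≤n⇒m<n∨m≡n (s≤s⁻¹ (subst (end c <_) (length-∷ʳ w x) (pos-range c (fromℕ k))))
  ... | inj₁ end<len =
    let (k<len , Rk≤) = least inv (restrict c end<len)
    in <-≤-trans k<len (rowInsert-length x R)
     , ≤-trans (rowInsert-≤ x R k k<len) (≤-trans Rk≤ (≤-reflexive (restrict-endValue c end<len)))
  ... | inj₂ endNew =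
    let (k<len , entry≤x) = rowInsert-bound x R k (belowX c endNew)
    in k<len , subst (rowInsert x R ! k ≤_) (sym (trans (cong ((w ∷ʳ x) !_) endNew) (!-∷ʳ-new w x))) entry≤x

heckeTableau-∷ʳ : ∀ w x → heckeTableau (w ∷ʳ x) ≡ heckeInsert (heckeTableau w) x
heckeTableau-∷ʳ w x = foldl-∷ʳ heckeInsert [] x w

heckeTableau-patience : ∀ w → isIncTab (heckeTableau w) ≡ true × PatienceRow w (firstRow (heckeTableau w))
heckeTableau-patience w = go w (reverseView w)
  where
  go : ∀ w → Reverse w → isIncTab (heckeTableau w) ≡ true × PatienceRow w (firstRow (heckeTableau w))
  go _ [] = refl , patience-[]
  go _ (w ∶ rw ∶ʳ x) rewrite heckeTableau-∷ʳ w x =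
    let (tableauInc , inv) = go w rw
    in heckeInsert-increasing (heckeTableau w) x tableauInc
     , subst (PatienceRow (w ∷ʳ x)) (sym (firstRow-heckeInsert (heckeTableau w) x tableauInc)) (patience-∷ʳ x inv)

lookup-! : ∀ w (i : Fin (length w)) → lookup w i ≡ w ! toℕ i
lookup-! (x ∷ w) fzero    = refl
lookup-! (x ∷ w) (fsuc i) = lookup-! w i

chainOf : ∀ {w k} → IncSubseq w (suc k) → Chain w k
chainOf {w} (f , posInc , valInc) = record
  { pos       = λ a → toℕ (f a)
  ; pos-inc   = posInc
  ; pos-range = λ a → toℕ<n (f a)
  ; val-inc   = increasing-cong (λ a → lookup-! w (f a)) valInc
  }

subseqOf : ∀ {w k} → Chain w k → IncSubseq w (suc k)
subseqOf {w} {k} c = f , fPosInc , fValInc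
  where
  f : Fin (suc k) → Fin (length w)
  f a = fromℕ< (pos-range c a)
  toℕ-f : ∀ a → pos c a ≡ toℕ (f a)
  toℕ-f a = sym (toℕ-fromℕ< (pos-range c a))
  fPosInc : ∀ a b → toℕ a < toℕ b → toℕ (f a) < toℕ (f b)
  fPosInc = increasing-cong toℕ-f (pos-inc c)
  fValInc : ∀ a b → toℕ a < toℕ b → lookup w (f a) < lookup w (f b)
  fValInc = increasing-cong (λ a → trans (cong (w !_) (toℕ-f a)) (sym (lookup-! w (f a)))) (val-inc c)

endingAt : ∀ {w k} (c : Chain w k) (j : Fin (length w)) → end c ≡ toℕ j → IncSubseqEndingAt w j (suc k)
endingAt {k = k} c j endj = subseqOf c , toℕ-injective (trans (toℕ-fromℕ< (pos-range c (fromℕ k))) endj)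

chainEndingAt : ∀ {w k} (j : Fin (length w)) → IncSubseqEndingAt w j (suc k) →
  Σ (Chain w k) λ c → end c ≡ toℕ j
chainEndingAt j (p , pEnd) = chainOf p , cong toℕ pEnd

endValue-at : ∀ {w k} (c : Chain w k) (j : Fin (length w)) → end c ≡ toℕ j → endValue c ≡ lookup w j
endValue-at {w} c j endj = trans (cong (w !_) endj) (sym (lookup-! w j))

patience-length : ∀ {w R s} → PatienceRow w R → IsLIS w s → length R ≡ s
patience-length {w} {R} inv (lisWitness , lisMax) = ≤-antisym (lisMax (length R) realised) (atMost lisWitness)
  where
  realised : IncSubseq w (length R)
  realised with length R in lenR
  ... | zero  = (λ ()) , (λ ()) , (λ ())
  ... | suc m = subseqOf (proj₁ (attained inv m (subst (m <_) (sym lenR) ≤-refl)))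
  atMost : ∀ {t} → IncSubseq w t → t ≤ length R
  atMost {zero}  _ = z≤n
  atMost {suc k} p = proj₁ (least inv (chainOf p))

patience-longestAt : ∀ {w R t} → PatienceRow w R → (c : Chain w t) → endValue c ≡ R ! t →
  (j : Fin (length w)) → end c ≡ toℕ j → LongestEndingAt w j (suc t)
patience-longestAt {w} {R} {t} inv c minimal j endj = endingAt c j endj , noLonger
  where
  noLonger : ∀ t′ → IncSubseqEndingAt w j t′ → t′ ≤ suc t
  noLonger (suc k) sub =
    let (c′ , endj′) = chainEndingAt j sub
        (k<len , Rk≤) = least inv c′
        Rk≤Rt : R ! k ≤ R ! t
        Rk≤Rt = subst (R ! k ≤_) (trans (endValue-at c′ j endj′) (trans (sym (endValue-at c j endj)) minimal)) Rk≤
    in s≤s (rowInc-reflect R k t (increasing inv) Rk≤Rt k<len)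

patience-entry : ∀ {w R} → PatienceRow w R → ∀ t j → IsR w (suc t) j → R ! t ≡ lookup w j
patience-entry {w} {R} inv t j ((atJ , longestAtJ) , lastSuch) = ≤-antisym Rt≤wj wj≤Rt
  where
  chainAtJ : Σ (Chain w t) λ c → end c ≡ toℕ j
  chainAtJ = chainEndingAt j atJ
  t<len : t < length R
  t<len = proj₁ (least inv (proj₁ chainAtJ))
  Rt≤wj : R ! t ≤ lookup w j
  Rt≤wj = subst (R ! t ≤_) (endValue-at (proj₁ chainAtJ) j (proj₂ chainAtJ)) (proj₂ (least inv (proj₁ chainAtJ)))
  c : Chain w t
  c = proj₁ (attained inv t t<len)
  minimal : endValue c ≡ R ! t
  minimal = proj₂ (attained inv t t<len)
  j′ : Fin (length w)
  j′ = fromℕ< (pos-range c (fromℕ t))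
  endj′ : end c ≡ toℕ j′
  endj′ = sym (toℕ-fromℕ< (pos-range c (fromℕ t)))
  j′≤j : end c ≤ toℕ j
  j′≤j = subst (_≤ toℕ j) (sym endj′) (lastSuch j′ (patience-longestAt inv c minimal j′ endj′))
  -- if w_j were larger than R ! t, c would extend to a chain of length t+2 ending at j
  wj≤Rt : lookup w j ≤ R ! t
  wj≤Rt with m≤n⇒m<n∨m≡n j′≤j
  ... | inj₂ j′≡j = ≤-reflexive (trans (sym (endValue-at c j j′≡j)) minimal)
  ... | inj₁ j′<j = ≮⇒≥ λ Rt<wj →
    let smaller = subst₂ _<_ (sym minimal) (lookup-! w j) Rt<wj
        longer = extend c (toℕ j) (toℕ<n j) j′<j smaller
    in 1+n≰n (longestAtJ (suc (suc t)) (endingAt longer j (extend-end c (toℕ j) (toℕ<n j) j′<j smaller)))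

list-ext : ∀ R n (f : Fin n → ℕ) → length R ≡ n → (∀ t → R ! toℕ t ≡ f t) → R ≡ tabulate f
list-ext []       zero    f refl entries = refl
list-ext (y ∷ ys) (suc n) f len  entries =
  cong₂ _∷_ (entries fzero) (list-ext ys n (λ t → f (fsuc t)) (suc-injective len) (λ t → entries (fsuc t)))

proposition4p1 : (q : ℕ) (w : List ℕ) → All (λ x → 1 ≤ x × x ≤ q) w →
    (s : ℕ) → IsLIS w s →
    (r : Fin s → Fin (length w)) → (∀ t → IsR w (suc (toℕ t)) (r t)) →
    firstRow (heckeTableau w) ≡ tabulate (λ t → lookup w (r t))
proposition4p1 q w _ s lis r isR =
  list-ext (firstRow (heckeTableau w)) s (λ t → lookup w (r t))
    (patience-length inv lis)
    (λ t → patience-entry inv (toℕ t) (r t) (isR t))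
  where inv : PatienceRow w (firstRow (heckeTableau w))
        inv = proj₂ (heckeTableau-patience w)
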